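{- Let $F_n$ be the friendship graph with $n\ge2$. Then $\gamma_t(M(F_n))= 2n$.
   Context: All graphs are finite and simple. The friendship graph $F_n$ of order $2n+1$ is obtained by joining $n$ copies of the cycle $C_3$ at a common vertex; i.e. it has vertices $v_0,v_1,\dots,v_{2n}$ and edges $v_0v_i$ for $1\le i\le 2n$ together with $v_{2k-1}v_{2k}$ for $1\le k\le n$. For a graph $H$ with no isolated vertices, a total dominating set of $H$ is a set $S\subseteq V(H)$ such that every vertex of $H$ has at least one neighbor in $S$; $\gamma_t(H)$ is the minimum cardinality of a total dominating set. The middle graph $M(G)$ of a graph $G$ has vertex set $V(G)\cup E(G)$ (disjoint union), and two of its vertices $x,y$ are adjacent exactly when either $x,y\in E(G)$ are edges of $G$ sharing a common endpoint, or $x\in V(G)$, $y\in E(G)$ and $x$ is an endpoint of $y$ (no two elements of $V(G)$ are adjacent in $M(G)$). -}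

module Defs where

open import Data.Nat using (ℕ; zero; suc; _+_; _*_; _≤_)
open import Data.Fin using (Fin; toℕ)
open import Data.Sum using (_⊎_; inj₁; inj₂)
open import Data.Product using (Σ; ∃; _×_; _,_)
open import Data.Empty using (⊥)
open import Data.List using (List; length)
open import Data.List.Membership.Propositional using (_∈_)
open import Data.List.Relation.Unary.Unique.Propositional using (Unique)
open import Relation.Binary.PropositionalEquality using (_≡_; _≢_)

record Graph : Set₁ where
  field
    Vtx : Set
    Adj : Vtx → Vtx → Set
open Graph public

-- A graph given by vertex set, edge set and incidence relation
-- (each edge is incident to exactly its two endpoints).
record IncGraph : Set₁ where
  field
    V   : Set
    E   : Set
    Inc : V → E → Set
open IncGraph public

MAdj : (G : IncGraph) → V G ⊎ E G → V G ⊎ E G → Set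
MAdj G (inj₁ v) (inj₁ w) = ⊥
MAdj G (inj₁ v) (inj₂ e) = Inc G v e
MAdj G (inj₂ e) (inj₁ v) = Inc G v e
MAdj G (inj₂ e) (inj₂ f) = (e ≢ f) × ∃ λ v → Inc G v e × Inc G v f

Middle : IncGraph → Graph
Middle G = record { Vtx = V G ⊎ E G ; Adj = MAdj G }

-- Friendship graph F_n: vertices v_0,…,v_{2n} (as Fin (1 + (n + n))).
-- Edges: spoke i (i : Fin (n + n)) is v_0 v_{i+1};
--        triangle edge k (k : Fin n) is v_{2k+1} v_{2k+2}.
FInc : (n : ℕ) → Fin (suc (n + n)) → Fin (n + n) ⊎ Fin n → Set
FInc n v (inj₁ i) = (toℕ v ≡ 0) ⊎ (toℕ v ≡ suc (toℕ i))
FInc n v (inj₂ k) = (toℕ v ≡ suc (2 * toℕ k)) ⊎ (toℕ v ≡ 2 + 2 * toℕ k)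

Friendship : ℕ → IncGraph
Friendship n = record
  { V = Fin (suc (n + n)) ; E = Fin (n + n) ⊎ Fin n ; Inc = FInc n }

IsTDS : (G : Graph) → List (Vtx G) → Set
IsTDS G S = ∀ x → ∃ λ y → y ∈ S × Adj G x y

TotalDomNumber : Graph → ℕ → Set
TotalDomNumber G k =
  (∃ λ S → Unique S × IsTDS G S × length S ≡ k) ×
  (∀ S → Unique S → IsTDS G S → k ≤ length S)

-- Away from the centre, M(F_n) splits into n blocks, one per triangle: its two outer
-- vertices, their spokes and the edge joining them. All neighbours of an outer vertex lie
-- in its block, and the two outer vertices of a triangle share only the triangle edge as a
-- neighbour; if a total dominating set uses that edge for both, the edge needs a neighbour
-- of its own in the set, again in the block. So every total dominating set meets each
-- block twice, giving 2n as a lower bound, and the 2n spokes attain it.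
module Submission where

open import Defs
open import Data.Nat using (ℕ; zero; suc; _+_; _*_; _≤_; _<_; pred; ⌊_/2⌋)
open import Data.Nat.Properties using (*-suc; +-suc; +-identityʳ; +-mono-≤; ≤-trans; n≤1+n; 1+n≢n; suc-injective)
open import Data.Fin as Fin using (Fin; toℕ; fromℕ<; splitAt)
open import Data.Fin.Properties using (toℕ-injective; toℕ<n; toℕ-fromℕ<; injective⇒≤; +↔⊎)
open import Data.Sum using (_⊎_; inj₁; inj₂; [_,_]′)
open import Data.Sum.Properties using (≡-dec)
open import Data.Product using (_,_)
open import Data.Empty using (⊥-elim)
open import Data.List using (List; length; tabulate; lookup)
open import Data.List.Membership.Propositional using (_∈_)
open import Data.List.Membership.Propositional.Properties using (∈-tabulate⁺)
open import Data.List.Relation.Unary.Any using (index)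
open import Data.List.Relation.Unary.Any.Properties using (lookup-index)
open import Data.List.Relation.Unary.Unique.Propositional using (Unique)
open import Data.List.Relation.Unary.Unique.Propositional.Properties using (tabulate⁺)
open import Data.List.Properties using (length-tabulate)
open import Function using (_∘_)
open import Function.Bundles using (Injection)
open import Function.Definitions using (Injective)
open import Function.Properties.Inverse using (↔⇒↣)
import Function.Construct.Composition as Compose
open import Relation.Nullary using (¬_; yes; no)
open import Relation.Binary.Definitions using (DecidableEquality)
open import Relation.Binary.PropositionalEquality

injective⇒≤-length : {A : Set} {m : ℕ} (S : List A) (g : Fin m → A) →
                     Injective _≡_ _≡_ g → (∀ i → g i ∈ S) → m ≤ length S
injective⇒≤-length S g g-inj g∈S = injective⇒≤ position-injective
  where
  position-injective : Injective _≡_ _≡_ (index ∘ g∈S)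
  position-injective {i} {j} e = g-inj (begin
    g i                      ≡⟨ lookup-index (g∈S i) ⟩
    lookup S (index (g∈S i)) ≡⟨ cong (lookup S) e ⟩
    lookup S (index (g∈S j)) ≡⟨ lookup-index (g∈S j) ⟨
    g j                      ∎)
    where open ≡-Reasoning

record TwoDistinct {A : Set} (P : A → Set) (S : List A) : Set where
  field
    fst snd : A
    fst∈S   : fst ∈ S
    snd∈S   : snd ∈ S
    fst≢snd : fst ≢ snd
    P-fst   : P fst
    P-snd   : P snd

twoInEachClass⇒≤-length :
  {A : Set} {n : ℕ} (S : List A) (P : Fin n → A → Set) →
  (∀ {k j x} → P k x → P j x → k ≡ j) →
  (∀ k → TwoDistinct (P k) S) → n + n ≤ length S
twoInEachClass⇒≤-length {A} {n} S P disjoint two =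
  injective⇒≤-length S (pick ∘ splitAt n)
    (Compose.injective _≡_ _≡_ _≡_ (Injection.injective (↔⇒↣ (+↔⊎ {n} {n}))) pick-injective)
    (pick∈S ∘ splitAt n)
  where
  open TwoDistinct
  pick : Fin n ⊎ Fin n → A
  pick (inj₁ k) = fst (two k)
  pick (inj₂ k) = snd (two k)

  pick∈S : ∀ c → pick c ∈ S
  pick∈S (inj₁ k) = fst∈S (two k)
  pick∈S (inj₂ k) = snd∈S (two k)

  class : Fin n ⊎ Fin n → Fin n
  class = [ (λ k → k) , (λ k → k) ]′

  P-pick : ∀ c → P (class c) (pick c)
  P-pick (inj₁ k) = P-fst (two k)
  P-pick (inj₂ k) = P-snd (two k)

  sameClass : ∀ c d → pick c ≡ pick d → class c ≡ class d
  sameClass c d e = disjoint (P-pick c) (subst (P (class d)) (sym e) (P-pick d))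

  pick-injective : Injective _≡_ _≡_ pick
  pick-injective {inj₁ k} {inj₁ j} e = cong inj₁ (sameClass (inj₁ k) (inj₁ j) e)
  pick-injective {inj₂ k} {inj₂ j} e = cong inj₂ (sameClass (inj₂ k) (inj₂ j) e)
  pick-injective {inj₁ k} {inj₂ j} e with sameClass (inj₁ k) (inj₂ j) e
  ... | refl = ⊥-elim (fst≢snd (two k) e)
  pick-injective {inj₂ k} {inj₁ j} e with sameClass (inj₂ k) (inj₁ j) e
  ... | refl = ⊥-elim (fst≢snd (two k) (sym e))

MAdj-irrefl : (G : IncGraph) (x : V G ⊎ E G) → ¬ MAdj G x x
MAdj-irrefl G (inj₁ v) ()
MAdj-irrefl G (inj₂ e) (e≢e , _) = e≢e refl

⌊2*n/2⌋≡n : ∀ m → ⌊ 2 * m /2⌋ ≡ m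
⌊2*n/2⌋≡n zero    = refl
⌊2*n/2⌋≡n (suc m) = trans (cong ⌊_/2⌋ (*-suc 2 m)) (cong suc (⌊2*n/2⌋≡n m))

⌊1+2*n/2⌋≡n : ∀ m → ⌊ suc (2 * m) /2⌋ ≡ m
⌊1+2*n/2⌋≡n zero    = refl
⌊1+2*n/2⌋≡n (suc m) = trans (cong (⌊_/2⌋ ∘ suc) (*-suc 2 m)) (cong suc (⌊1+2*n/2⌋≡n m))

k<n⇒2+2k≤n+n : ∀ {k n} → k < n → 2 + 2 * k ≤ n + n
k<n⇒2+2k≤n+n {k} k<n rewrite +-identityʳ k | sym (+-suc k k) = +-mono-≤ k<n k<n

module _ (n : ℕ) where

  private
    F : IncGraph
    F = Friendship n

  Element : Set
  Element = V F ⊎ E F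

  -- Triangle k (from 0) is v_{2k+1}, v_{2k+2}, their spokes and the edge between them.
  -- The centre v_0 is in no block; its junk value ⌊ pred 0 /2⌋ = 0 is never used.
  triangleOf : Element → ℕ
  triangleOf (inj₁ v)        = ⌊ pred (toℕ v) /2⌋
  triangleOf (inj₂ (inj₁ i)) = ⌊ toℕ i /2⌋
  triangleOf (inj₂ (inj₂ k)) = toℕ k

  InTriangle : Fin n → Element → Set
  InTriangle k x = triangleOf x ≡ toℕ k

  incident⇒sameTriangle : ∀ {v} e → toℕ v ≢ 0 → FInc n v e →
                          triangleOf (inj₂ e) ≡ triangleOf (inj₁ v)
  incident⇒sameTriangle (inj₁ i) v≢0 (inj₁ v≡0) = ⊥-elim (v≢0 v≡0)
  incident⇒sameTriangle (inj₁ i) _   (inj₂ p) rewrite p = refl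
  incident⇒sameTriangle (inj₂ k) _   (inj₁ p) rewrite p = sym (⌊2*n/2⌋≡n (toℕ k))
  incident⇒sameTriangle (inj₂ k) _   (inj₂ p) rewrite p = sym (⌊1+2*n/2⌋≡n (toℕ k))

  triangleEdge-avoids-centre : ∀ {v} k → FInc n v (inj₂ k) → toℕ v ≢ 0
  triangleEdge-avoids-centre _ (inj₁ p) v≡0 with trans (sym p) v≡0
  ... | ()
  triangleEdge-avoids-centre _ (inj₂ p) v≡0 with trans (sym p) v≡0
  ... | ()

  triangleEdge-neighbour : ∀ {k} y → MAdj F (inj₂ (inj₂ k)) y → InTriangle k y
  triangleEdge-neighbour {k} (inj₁ v) v∈k =
    sym (incident⇒sameTriangle (inj₂ k) (triangleEdge-avoids-centre k v∈k) v∈k)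
  triangleEdge-neighbour {k} (inj₂ f) (_ , w , w∈k , w∈f) =
    trans (incident⇒sameTriangle f w≢0 w∈f) (sym (incident⇒sameTriangle (inj₂ k) w≢0 w∈k))
    where w≢0 = triangleEdge-avoids-centre k w∈k

  triangleVertex-neighbour : ∀ {v k} y → FInc n v (inj₂ k) → MAdj F (inj₁ v) y → InTriangle k y
  triangleVertex-neighbour {k = k} (inj₂ e) v∈k v∈e =
    trans (incident⇒sameTriangle e (triangleEdge-avoids-centre k v∈k) v∈e)
          (triangleEdge-neighbour (inj₁ _) v∈k)

  spoke-outerEnd-unique : ∀ {v w i} → toℕ v ≢ 0 → toℕ w ≢ 0 →
                          FInc n v (inj₁ i) → FInc n w (inj₁ i) → toℕ v ≡ toℕ w
  spoke-outerEnd-unique v≢0 _   (inj₁ v≡0) _          = ⊥-elim (v≢0 v≡0)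
  spoke-outerEnd-unique _   w≢0 _          (inj₁ w≡0) = ⊥-elim (w≢0 w≡0)
  spoke-outerEnd-unique _   _   (inj₂ p)   (inj₂ q)   = trans p (sym q)

  -- tip₁ k = v_{2k+1} and tip₂ k = v_{2k+2}, reached from v_0 by spoke₁ k and spoke₂ k.
  spoke₁ spoke₂ : Fin n → Fin (n + n)
  spoke₁ k = fromℕ< (≤-trans (n≤1+n _) (k<n⇒2+2k≤n+n (toℕ<n k)))
  spoke₂ k = fromℕ< (k<n⇒2+2k≤n+n (toℕ<n k))

  tip₁ tip₂ : Fin n → V F
  tip₁ k = Fin.suc (spoke₁ k)
  tip₂ k = Fin.suc (spoke₂ k)

  tip₁∈triangleEdge : ∀ k → FInc n (tip₁ k) (inj₂ k)
  tip₁∈triangleEdge k = inj₁ (cong suc (toℕ-fromℕ< _))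

  tip₂∈triangleEdge : ∀ k → FInc n (tip₂ k) (inj₂ k)
  tip₂∈triangleEdge k = inj₂ (cong suc (toℕ-fromℕ< _))

  tip₁≢tip₂ : ∀ k → toℕ (tip₁ k) ≢ toℕ (tip₂ k)
  tip₁≢tip₂ k e = 1+n≢n (begin
    suc (2 * toℕ k)  ≡⟨ toℕ-fromℕ< _ ⟨
    toℕ (spoke₂ k)   ≡⟨ suc-injective e ⟨
    toℕ (spoke₁ k)   ≡⟨ toℕ-fromℕ< _ ⟩
    2 * toℕ k        ∎)
    where open ≡-Reasoning

  private
    _≟_ : DecidableEquality Element
    _≟_ = ≡-dec Fin._≟_ (≡-dec Fin._≟_ Fin._≟_)

  twoInTriangle : (S : List Element) → IsTDS (Middle F) S → ∀ k → TwoDistinct (InTriangle k) S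
  twoInTriangle S tds k with tds (inj₁ (tip₁ k)) | tds (inj₁ (tip₂ k))
  ... | y₁ , y₁∈S , tip₁~y₁ | y₂ , y₂∈S , tip₂~y₂ with y₁ ≟ y₂
  ... | no y₁≢y₂ = record
    { fst = y₁ ; snd = y₂ ; fst∈S = y₁∈S ; snd∈S = y₂∈S ; fst≢snd = y₁≢y₂
    ; P-fst = triangleVertex-neighbour y₁ (tip₁∈triangleEdge k) tip₁~y₁
    ; P-snd = triangleVertex-neighbour y₂ (tip₂∈triangleEdge k) tip₂~y₂
    }
  ... | yes refl = commonNeighbour y₁ y₁∈S tip₁~y₁ tip₂~y₂
    where
    -- A common neighbour of both tips is the triangle edge, whose own neighbour in S is the second element.
    commonNeighbour : ∀ y → y ∈ S → MAdj F (inj₁ (tip₁ k)) y → MAdj F (inj₁ (tip₂ k)) y →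
                      TwoDistinct (InTriangle k) S
    commonNeighbour (inj₁ _)        _   () _
    commonNeighbour (inj₂ (inj₁ i)) _   p  q =
      ⊥-elim (tip₁≢tip₂ k (spoke-outerEnd-unique (λ ()) (λ ()) p q))
    commonNeighbour y@(inj₂ (inj₂ j)) y∈S p _ with tds y
    ... | z , z∈S , y~z = record
      { fst = y ; snd = z ; fst∈S = y∈S ; snd∈S = z∈S
      ; fst≢snd = λ { refl → MAdj-irrefl F z y~z }
      ; P-fst = y∈k
      ; P-snd = trans (triangleEdge-neighbour z y~z) y∈k
      }
      where y∈k = triangleVertex-neighbour y (tip₁∈triangleEdge k) p

  totalDominating⇒2n≤length : (S : List Element) → IsTDS (Middle F) S → n + n ≤ length S
  totalDominating⇒2n≤length S tds =
    twoInEachClass⇒≤-length S InTriangle (λ x∈k x∈j → toℕ-injective (trans (sym x∈k) x∈j))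
      (twoInTriangle S tds)

  spokes : List Element
  spokes = tabulate (inj₂ ∘ inj₁)

  length-spokes : length spokes ≡ n + n
  length-spokes = length-tabulate (inj₂ ∘ inj₁)

  spokes-unique : Unique spokes
  spokes-unique = tabulate⁺ λ { refl → refl }

spokes-totalDominating : ∀ m → IsTDS (Middle (Friendship (suc m))) (spokes (suc m))
spokes-totalDominating m = dominated
  where
  n = suc m

  spoke : Fin (n + n) → Element n
  spoke = inj₂ ∘ inj₁

  spoke∈spokes : ∀ i → spoke i ∈ spokes n
  spoke∈spokes = ∈-tabulate⁺ {f = spoke}

  dominated : IsTDS (Middle (Friendship n)) (spokes n)
  dominated (inj₁ Fin.zero)          = spoke Fin.zero , spoke∈spokes _ , inj₁ refl
  dominated (inj₁ (Fin.suc i))       = spoke i , spoke∈spokes i , inj₂ refl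
  dominated (inj₂ (inj₁ Fin.zero))   =
    spoke (spoke₂ n Fin.zero) , spoke∈spokes _ , (λ ()) , Fin.zero , inj₁ refl , inj₁ refl
  dominated (inj₂ (inj₁ (Fin.suc i))) =
    spoke Fin.zero , spoke∈spokes _ , (λ ()) , Fin.zero , inj₁ refl , inj₁ refl
  dominated (inj₂ (inj₂ k))          =
    spoke (spoke₁ n k) , spoke∈spokes _ , (λ ()) , tip₁ n k , tip₁∈triangleEdge n k , inj₂ refl

proposition2p14 : (n : ℕ) → 2 ≤ n → TotalDomNumber (Middle (Friendship n)) (n + n)
proposition2p14 (suc m) _ =
  (spokes (suc m) , spokes-unique (suc m) , spokes-totalDominating m , length-spokes (suc m)) ,
  λ S _ → totalDominating⇒2n≤length (suc m) S
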